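{- Let $\Sigma$ be a monoidal signature, $G$ a (possibly infinite) $\Sigma$-hypergraph, and $n\xrightarrow{\iota}G'\xleftarrow{\omega}m$ an arrow of $\mathsf{DiscCospan}(\mathbf{Hyp}_\Sigma)$. Then \[\mathcal U_G(n\xrightarrow{\iota}G'\xleftarrow{\omega}m)=\Big(\mathbf{Hyp}^\infty_\Sigma[n,G]\xleftarrow{\iota;- }\mathbf{Hyp}^\infty_\Sigma[G',G]\xrightarrow{\omega;- }\mathbf{Hyp}^\infty_\Sigma[m,G]\Big),\] where $\mathbf{Hyp}^\infty_\Sigma[A,B]$ denotes the set of hypergraph homomorphisms $A\to B$ and $(\iota;-)(f)=\iota;f$, $(\omega;-)(f)=\omega;f$ (precomposition).
   Context: A monoidal signature $\Sigma$ is a set of symbols each with arity $n$ and coarity $m$ ($\Sigma_{n,m}$). A $\Sigma$-hypergraph $G$ is a set $G_V$ and, for each $R\in\Sigma_{n,m}$, a set $G_R$ with $s_R:G_R\to(G_V)^n$, $t_R:G_R\to(G_V)^m$; homomorphisms $f:G\to G'$ are $f_V:G_V\to G'_V$ and $f_R:G_R\to G'_R$ commuting with sources and targets. $\mathbf{Hyp}^\infty_\Sigma$ is the category of all $\Sigma$-hypergraphs, $\mathbf{Hyp}_\Sigma$ its full subcategory of finite ones. A finite ordinal $n$ is viewed as the discrete hypergraph with vertices $\{0,\dots,n-1\}$ and no edges, so $\mathbf{Hyp}^\infty_\Sigma[n,G]=(G_V)^n$. $\mathsf{DiscCospan}(\mathbf{Hyp}_\Sigma)$ has finite ordinals as objects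 and isomorphism classes of cospans $n\to G'\leftarrow m$ in $\mathbf{Hyp}_\Sigma$ as arrows, composed by pushout, tensor by coproduct, preorder $(n\to A\leftarrow m)\le(n\to B\leftarrow m)$ iff there is a homomorphism $B\to A$ commuting with the legs; monoid on $X$: $X+X\xrightarrow{[\mathrm{id},\mathrm{id}]}X\xleftarrow{\mathrm{id}}X$, $0\to X\xleftarrow{\mathrm{id}}X$, comonoid: reversed cospans. $\mathsf{Span}^{\leq}(\mathbf{Set})$ has sets as objects, isomorphism classes of spans as arrows, composition by pullback, tensor by cartesian product, $(X\leftarrow A\to Y)\le(X\leftarrow B\to Y)$ iff there is a function $A\to B$ commuting with the legs, comonoid $X\xleftarrow{\mathrm{id}}X\xrightarrow{\langle\mathrm{id},\mathrm{id}\rangle}X\times X$, $X\xleftarrow{\mathrm{id}}X\to1$, monoid the reversed spans. For $R\in\Sigma_{n,m}$, let $\lfloor R\rfloor$ be the cospan $n\to H_R\leftarrow m$ where $H_R$ has $n+m$ vertices and a single $R$-edge with source the first $n$ and target the last $m$ vertices, the legs being the evident injections. For a $\Sigma$-hypergraph $G$, $\mathcal U_G:\mathsf{DiscCospan}(\mathbf{Hyp}_\Sigma)\to\mathsf{Span}^{\leq}(\mathbf{Set})$ is the unique morphism of preordered cartesian bicategories (monoidal functor preserving preorders, monoids and comonoids) with $\mathcal U_G(1)=G_V$ and $\mathcal U_G(\lfloor R\rfloor)=\big((G_V)^n\xleftarrow{s_R}G_R\xrightarrow{t_R}(G_V)^m\big)$ for all $R\in\Sigma_{n,m}$. -}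

module Defs where

open import Data.Nat using (ℕ; zero; suc; _+_)
open import Data.Fin using (Fin; zero; suc; _↑ˡ_; _↑ʳ_; splitAt)
open import Data.Sum using ([_,_]′)
open import Data.Vec using (Vec; []; _∷_; tabulate; map; _++_; take; drop)
open import Data.Vec.Properties using (map-∘)
open import Data.Product using (Σ; Σ-syntax; _×_; _,_; proj₁; proj₂)
open import Function using (id; _∘_)
open import Relation.Binary.PropositionalEquality

record Signature : Set₁ where
  field
    Sym  : Set
    ar   : Sym → ℕ
    coar : Sym → ℕ
open Signature public

-- A (possibly infinite) Σ-hypergraph (an object of Hyp^∞_Σ).
record Hyp (S : Signature) : Set₁ where
  field
    V   : Set
    E   : Sym S → Set
    src : ∀ R → E R → Vec V (ar S R)
    tgt : ∀ R → E R → Vec V (coar S R)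
open Hyp public

record Hom {S : Signature} (H K : Hyp S) : Set where
  field
    fV       : V H → V K
    fE       : ∀ R → E H R → E K R
    src-comm : ∀ R x → src K R (fE R x) ≡ map fV (src H R x)
    tgt-comm : ∀ R x → tgt K R (fE R x) ≡ map fV (tgt H R x)
open Hom public

_⨾_ : ∀ {S} {H K L : Hyp S} → Hom H K → Hom K L → Hom H L
_⨾_ {L = L} f g = record
  { fV = fV g ∘ fV f
  ; fE = λ R → fE g R ∘ fE f R
  ; src-comm = λ R x → trans (src-comm g R (fE f R x))
      (trans (cong (map (fV g)) (src-comm f R x)) (sym (map-∘ (fV g) (fV f) _)))
  ; tgt-comm = λ R x → trans (tgt-comm g R (fE f R x))
      (trans (cong (map (fV g)) (tgt-comm f R x)) (sym (map-∘ (fV g) (fV f) _)))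
  }

idH : ∀ {S} {H : Hyp S} → Hom H H
idH {H = H} = record
  { fV = id ; fE = λ R → id
  ; src-comm = λ R x → sym (map-id (src H R x))
  ; tgt-comm = λ R x → sym (map-id (tgt H R x)) }
  where
  map-id : ∀ {A : Set} {k} (v : Vec A k) → map id v ≡ v
  map-id [] = refl
  map-id (a ∷ v) = cong (a ∷_) (map-id v)

-- Equality of homomorphisms (functions are compared extensionally,
-- as in set theory).
record _≈H_ {S} {H K : Hyp S} (f g : Hom H K) : Set where
  field
    eqV : ∀ v → fV f v ≡ fV g v
    eqE : ∀ R x → fE f R x ≡ fE g R x

-- Finite Σ-hypergraphs (objects of Hyp_Σ): finitely many vertices Fin k
-- and finitely many edges Fin e, each edge i labelled by a symbol lab i.

record FinHyp (S : Signature) : Set where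
  field
    k    : ℕ
    e    : ℕ
    lab  : Fin e → Sym S
    fsrc : (i : Fin e) → Vec (Fin k) (ar S (lab i))
    ftgt : (i : Fin e) → Vec (Fin k) (coar S (lab i))
open FinHyp public

-- The underlying Σ-hypergraph: G_R is the set of edges labelled R.
⟦_⟧ : ∀ {S} → FinHyp S → Hyp S
⟦ H ⟧ = record
  { V = Fin (k H)
  ; E = λ R → Σ[ i ∈ Fin (e H) ] lab H i ≡ R
  ; src = λ { R (i , refl) → fsrc H i }
  ; tgt = λ { R (i , refl) → ftgt H i } }

FHom : ∀ {S} → FinHyp S → FinHyp S → Set
FHom H K = Hom ⟦ H ⟧ ⟦ K ⟧

disc : ∀ {S} → ℕ → FinHyp S
disc n = record { k = n ; e = 0 ; lab = λ () ; fsrc = λ () ; ftgt = λ () }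

discHom : ∀ {S} {n} {K : Hyp S} → (Fin n → V K) → Hom ⟦ disc {S} n ⟧ K
discHom f = record
  { fV = f ; fE = λ { R (() , _) } ; src-comm = λ { R (() , _) }
  ; tgt-comm = λ { R (() , _) } }

-- Cospans n → G' ← m in Hyp_Σ (arrows of DiscCospan(Hyp_Σ), taken up to
-- isomorphism of cospans).

record Cospan (S : Signature) (n m : ℕ) : Set where
  field
    apex : FinHyp S
    ι    : FHom (disc n) apex
    ω    : FHom (disc m) apex
open Cospan public

record CospanIso {S n m} (c d : Cospan S n m) : Set where
  field
    to     : FHom (apex c) (apex d)
    from   : FHom (apex d) (apex c)
    from∘to : (to ⨾ from) ≈H idH
    to∘from : (from ⨾ to) ≈H idH
    ι-comm : (ι c ⨾ to) ≈H ι d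
    ω-comm : (ω c ⨾ to) ≈H ω d

_≤C_ : ∀ {S n m} → Cospan S n m → Cospan S n m → Set
c ≤C d = Σ[ h ∈ FHom (apex d) (apex c) ] ((ι d ⨾ h) ≈H ι c × (ω d ⨾ h) ≈H ω c)

IsPushout : ∀ {S} {A B C P : FinHyp S} →
  FHom A B → FHom A C → FHom B P → FHom C P → Set
IsPushout {S} {A} {B} {C} {P} f g j₁ j₂ =
  (f ⨾ j₁) ≈H (g ⨾ j₂) ×
  (∀ (Q : FinHyp S) (a : FHom B Q) (b : FHom C Q) → (f ⨾ a) ≈H (g ⨾ b) →
     Σ[ u ∈ FHom P Q ] ((j₁ ⨾ u) ≈H a × (j₂ ⨾ u) ≈H b ×
       (∀ (u' : FHom P Q) → (j₁ ⨾ u') ≈H a → (j₂ ⨾ u') ≈H b → u' ≈H u)))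

IsCoproduct : ∀ {S} {B C P : FinHyp S} → FHom B P → FHom C P → Set
IsCoproduct {S} {B} {C} {P} j₁ j₂ =
  ∀ (Q : FinHyp S) (a : FHom B Q) (b : FHom C Q) →
     Σ[ u ∈ FHom P Q ] ((j₁ ⨾ u) ≈H a × (j₂ ⨾ u) ≈H b ×
       (∀ (u' : FHom P Q) → (j₁ ⨾ u') ≈H a → (j₂ ⨾ u') ≈H b → u' ≈H u))

-- e is (a representative of) the composite c ; d, computed by pushout.
IsComposite : ∀ {S n m p} → Cospan S n m → Cospan S m p → Cospan S n p → Set
IsComposite c d x =
  Σ[ j₁ ∈ FHom (apex c) (apex x) ] Σ[ j₂ ∈ FHom (apex d) (apex x) ]
    (IsPushout (ω c) (ι d) j₁ j₂ × (ι c ⨾ j₁) ≈H ι x × (ω d ⨾ j₂) ≈H ω x)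

inlD : ∀ {S} n n' → FHom {S} (disc n) (disc (n + n'))
inlD n n' = discHom (_↑ˡ n')

inrD : ∀ {S} n n' → FHom {S} (disc n') (disc (n + n'))
inrD n n' = discHom (n ↑ʳ_)

-- x is (a representative of) the tensor c ⊕ d, computed by coproduct.
IsTensor : ∀ {S n m n' m'} → Cospan S n m → Cospan S n' m' →
  Cospan S (n + n') (m + m') → Set
IsTensor {n = n} {m} {n'} {m'} c d x =
  Σ[ j₁ ∈ FHom (apex c) (apex x) ] Σ[ j₂ ∈ FHom (apex d) (apex x) ]
    (IsCoproduct j₁ j₂ ×
     (inlD n n' ⨾ ι x) ≈H (ι c ⨾ j₁) × (inrD n n' ⨾ ι x) ≈H (ι d ⨾ j₂) ×
     (inlD m m' ⨾ ω x) ≈H (ω c ⨾ j₁) × (inrD m m' ⨾ ω x) ≈H (ω d ⨾ j₂))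

idC : ∀ {S} n → Cospan S n n
idC n = record { apex = disc n ; ι = idH ; ω = idH }

μC : ∀ {S} n → Cospan S (n + n) n
μC n = record { apex = disc n ; ι = discHom ([ id , id ]′ ∘ splitAt n) ; ω = idH }

ηC : ∀ {S} n → Cospan S 0 n
ηC n = record { apex = disc n ; ι = discHom (λ ()) ; ω = idH }

δC : ∀ {S} n → Cospan S n (n + n)
δC n = record { apex = disc n ; ι = idH ; ω = discHom ([ id , id ]′ ∘ splitAt n) }

εC : ∀ {S} n → Cospan S n 0
εC n = record { apex = disc n ; ι = idH ; ω = discHom (λ ()) }

σC : ∀ {S} n m → Cospan S (n + m) (m + n)
σC n m = record { apex = disc (m + n)
                ; ι = discHom ([ (m ↑ʳ_) , (_↑ˡ n) ]′ ∘ splitAt n) ; ω = idH }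

H[_] : ∀ {S} → Sym S → FinHyp S
H[_] {S} R = record
  { k = ar S R + coar S R ; e = 1 ; lab = λ _ → R
  ; fsrc = λ _ → tabulate (_↑ˡ coar S R)
  ; ftgt = λ _ → tabulate (ar S R ↑ʳ_) }

⌊_⌋ : ∀ {S} (R : Sym S) → Cospan S (ar S R) (coar S R)
⌊_⌋ {S} R = record { apex = H[ R ]
                   ; ι = discHom (_↑ˡ coar S R) ; ω = discHom (ar S R ↑ʳ_) }

record Span (X Y : Set) : Set₁ where
  field
    top : Set
    lft : top → X
    rgt : top → Y
open Span public

-- Isomorphism of spans, with the apex of the target compared by a given
-- equality _∼_ (normally _≡_).
record SpanIsoBy {X Y} (P Q : Span X Y) (_∼_ : top Q → top Q → Set) : Set where
  field
    φ     : top P → top Q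
    ψ     : top Q → top P
    ψφ    : ∀ a → ψ (φ a) ≡ a
    φψ    : ∀ b → φ (ψ b) ∼ b
    l-comm : ∀ a → lft Q (φ a) ≡ lft P a
    r-comm : ∀ a → rgt Q (φ a) ≡ rgt P a

_≅S_ : ∀ {X Y} → Span X Y → Span X Y → Set
P ≅S Q = SpanIsoBy P Q _≡_

_≤S_ : ∀ {X Y} → Span X Y → Span X Y → Set
P ≤S Q = Σ[ h ∈ (top P → top Q) ]
  ((∀ a → lft Q (h a) ≡ lft P a) × (∀ a → rgt Q (h a) ≡ rgt P a))

_⨾S_ : ∀ {X Y Z} → Span X Y → Span Y Z → Span X Z
P ⨾S Q = record
  { top = Σ[ ab ∈ top P × top Q ] rgt P (proj₁ ab) ≡ lft Q (proj₂ ab)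
  ; lft = λ { ((a , b) , _) → lft P a }
  ; rgt = λ { ((a , b) , _) → rgt Q b } }

idS : ∀ X → Span X X
idS X = record { top = X ; lft = id ; rgt = id }

-- Tensor (cartesian product), with (G_V)^n × (G_V)^n' = (G_V)^(n+n').
_⊗S_ : ∀ {A : Set} {n m n' m'} → Span (Vec A n) (Vec A m) →
  Span (Vec A n') (Vec A m') → Span (Vec A (n + n')) (Vec A (m + m'))
P ⊗S Q = record
  { top = top P × top Q
  ; lft = λ { (a , b) → lft P a ++ lft Q b }
  ; rgt = λ { (a , b) → rgt P a ++ rgt Q b } }

δS : ∀ (A : Set) n → Span (Vec A n) (Vec A (n + n))
δS A n = record { top = Vec A n ; lft = id ; rgt = λ v → v ++ v }

εS : ∀ (A : Set) n → Span (Vec A n) (Vec A 0)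
εS A n = record { top = Vec A n ; lft = id ; rgt = λ _ → [] }

μS : ∀ (A : Set) n → Span (Vec A (n + n)) (Vec A n)
μS A n = record { top = Vec A n ; lft = λ v → v ++ v ; rgt = id }

ηS : ∀ (A : Set) n → Span (Vec A 0) (Vec A n)
ηS A n = record { top = Vec A n ; lft = λ _ → [] ; rgt = id }

σS : ∀ (A : Set) n m → Span (Vec A (n + m)) (Vec A (m + n))
σS A n m = record { top = Vec A (n + m) ; lft = id
                  ; rgt = λ v → drop n v ++ take n v }

-- Morphisms of preordered cartesian bicategories
-- DiscCospan(Hyp_Σ) → Span^≤(Set) sending the object 1 to G_V (hence
-- the object n to (G_V)^n).

CospanToSpan : ∀ (S : Signature) (A : Set) → Set₁
CospanToSpan S A = ∀ {n m} → Cospan S n m → Span (Vec A n) (Vec A m)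

record IsPCBMorphism (S : Signature) (A : Set) (F : CospanToSpan S A) : Set₁ where
  field
    -- well defined on isomorphism classes of cospans
    resp-iso   : ∀ {n m} {c d : Cospan S n m} → CospanIso c d → F c ≅S F d
    pres-id    : ∀ n → F (idC n) ≅S idS (Vec A n)
    pres-comp  : ∀ {n m p} (c : Cospan S n m) (d : Cospan S m p)
                   (x : Cospan S n p) → IsComposite c d x → F x ≅S (F c ⨾S F d)
    pres-tensor : ∀ {n m n' m'} (c : Cospan S n m) (d : Cospan S n' m')
                   (x : Cospan S (n + n') (m + m')) → IsTensor c d x →
                   F x ≅S (F c ⊗S F d)
    pres-sym   : ∀ n m → F (σC n m) ≅S σS A n m
    pres-≤     : ∀ {n m} {c d : Cospan S n m} → c ≤C d → F c ≤S F d
    pres-μ     : ∀ n → F (μC n) ≅S μS A n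
    pres-η     : ∀ n → F (ηC n) ≅S ηS A n
    pres-δ     : ∀ n → F (δC n) ≅S δS A n
    pres-ε     : ∀ n → F (εC n) ≅S εS A n

genSpan : ∀ {S} (G : Hyp S) (R : Sym S) → Span (Vec (V G) (ar S R)) (Vec (V G) (coar S R))
genSpan G R = record { top = E G R ; lft = src G R ; rgt = tgt G R }

-- Hyp^∞[n,G] is identified with (G_V)^n via the vertex map.
homVec : ∀ {S} {n} {G : Hyp S} → Hom ⟦ disc {S} n ⟧ G → Vec (V G) n
homVec h = tabulate (fV h)

homSpan : ∀ {S} (G : Hyp S) {n m} (c : Cospan S n m) → Span (Vec (V G) n) (Vec (V G) m)
homSpan G c = record
  { top = Hom ⟦ apex c ⟧ G
  ; lft = λ f → homVec (ι c ⨾ f)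
  ; rgt = λ f → homVec (ω c ⨾ f) }

module Submission where

-- Say that U agrees with Hom(-, G) on a cospan c when U c is isomorphic to
-- the hom-span of c, by an isomorphism whose inverse respects equality of
-- homomorphisms.  Agreement is closed under composition and tensor: U preserves
-- them, and Hom(-, G) turns pushouts and coproducts of finite hypergraphs, which
-- stay universal among all hypergraphs, into pullbacks and products of sets.  It
-- holds for the generators ⌊R⌋ by hypothesis, and for identities, (co)monoids and
-- (co)units because U preserves them.  Every cospan is built from these: cospans
-- of functions between finite ordinals from (co)monoids and (co)units; a single
-- edge from ⌊R⌋ ⊗ id_K by gluing its endpoints; a hypergraph H, as a cospan from
-- and to its vertices, edge by edge; and n → H ← m as  fun ι ; H ; op ω.

open import Defs
open import Axiom.UniquenessOfIdentityProofs.WithK using (uip)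
open import Data.Nat using (ℕ; zero; suc; _+_)
open import Data.Fin using (Fin; zero; suc; _↑ˡ_; _↑ʳ_; splitAt)
open import Data.Fin.Properties using (splitAt⁻¹-↑ˡ; splitAt⁻¹-↑ʳ)
open import Data.Sum using (inj₁; inj₂)
open import Data.Vec using (Vec; tabulate; map; _++_; lookup)
open import Data.Vec.Properties
  using (lookup∘tabulate; tabulate∘lookup; tabulate-cong; tabulate-∘; map-cong; map-∘; map-id;
         lookup-++ˡ; lookup-++ʳ; lookup-map)
open import Data.Vec.Functional using () renaming (_++_ to _++ᶠ_)
open import Data.Vec.Functional.Properties using ()
  renaming (lookup-++ˡ to ++ᶠ-↑ˡ; lookup-++ʳ to ++ᶠ-↑ʳ)
open import Data.Product using (_,_; proj₁; proj₂)
open import Function using (id; _∘_)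
open import Relation.Binary.PropositionalEquality

↑-cases : ∀ m {n} {A : Set} {F G : Fin (m + n) → A} →
  (∀ i → F (i ↑ˡ n) ≡ G (i ↑ˡ n)) → (∀ j → F (m ↑ʳ j) ≡ G (m ↑ʳ j)) → ∀ x → F x ≡ G x
↑-cases m {F = F} {G} onˡ onʳ x with splitAt m x in eq
... | inj₁ i = subst (λ y → F y ≡ G y) (splitAt⁻¹-↑ˡ eq) (onˡ i)
... | inj₂ j = subst (λ y → F y ≡ G y) (splitAt⁻¹-↑ʳ eq) (onʳ j)

_⊕_ : ∀ {n n′ K K′} → (Fin n → Fin K) → (Fin n′ → Fin K′) → Fin (n + n′) → Fin (K + K′)
_⊕_ {K = K} {K′} f g = (λ i → f i ↑ˡ K′) ++ᶠ (λ j → K ↑ʳ g j)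

⊕-↑ˡ : ∀ {n n′ K K′} (f : Fin n → Fin K) (g : Fin n′ → Fin K′) i → (f ⊕ g) (i ↑ˡ n′) ≡ f i ↑ˡ K′
⊕-↑ˡ {K = K} {K′} f g = ++ᶠ-↑ˡ (λ i → f i ↑ˡ K′) (λ j → K ↑ʳ g j)

⊕-↑ʳ : ∀ {n n′ K K′} (f : Fin n → Fin K) (g : Fin n′ → Fin K′) j → (f ⊕ g) (n ↑ʳ j) ≡ K ↑ʳ g j
⊕-↑ʳ {K = K} {K′} f g = ++ᶠ-↑ʳ (λ i → f i ↑ˡ K′) (λ j → K ↑ʳ g j)

∇ : ∀ K → Fin (K + K) → Fin K
∇ K = id ++ᶠ id

tabulate-injective : ∀ {A : Set} {n} {F G : Fin n → A} → tabulate F ≡ tabulate G → ∀ i → F i ≡ G i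
tabulate-injective {F = F} {G} eq i =
  trans (sym (lookup∘tabulate F i)) (trans (cong (λ v → lookup v i) eq) (lookup∘tabulate G i))

tabulate-split : ∀ {A : Set} {m n} {F : Fin (m + n) → A} {F₁ : Fin m → A} {F₂ : Fin n → A} →
  (∀ i → F (i ↑ˡ n) ≡ F₁ i) → (∀ j → F (m ↑ʳ j) ≡ F₂ j) → tabulate F ≡ tabulate F₁ ++ tabulate F₂
tabulate-split {m = m} {n} {F} {F₁} {F₂} onˡ onʳ = begin
  tabulate F                                  ≡⟨ tabulate-cong (↑-cases m onˡ′ onʳ′) ⟩
  tabulate (lookup (tabulate F₁ ++ tabulate F₂)) ≡⟨ tabulate∘lookup _ ⟩
  tabulate F₁ ++ tabulate F₂                  ∎
  where
  open ≡-Reasoning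
  onˡ′ : ∀ i → F (i ↑ˡ n) ≡ lookup (tabulate F₁ ++ tabulate F₂) (i ↑ˡ n)
  onˡ′ i = trans (onˡ i) (sym (trans (lookup-++ˡ (tabulate F₁) _ i) (lookup∘tabulate F₁ i)))
  onʳ′ : ∀ j → F (m ↑ʳ j) ≡ lookup (tabulate F₁ ++ tabulate F₂) (m ↑ʳ j)
  onʳ′ j = trans (onʳ j) (sym (trans (lookup-++ʳ (tabulate F₁) _ j) (lookup∘tabulate F₂ j)))

tabulate-rename : ∀ {A B : Set} {n} (r : A → B) {F : Fin n → A} {F′ : Fin n → B} →
  (∀ i → r (F i) ≡ F′ i) → tabulate F′ ≡ map r (tabulate F)
tabulate-rename r eq = trans (tabulate-cong (λ i → sym (eq i))) (tabulate-∘ r _)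

tabulate-∇ : ∀ {A : Set} {K} (v : Vec A K) → tabulate (lookup v ∘ ∇ K) ≡ v ++ v
tabulate-∇ v = trans (tabulate-split (λ i → cong (lookup v) (++ᶠ-↑ˡ id id i))
                                     (λ j → cong (lookup v) (++ᶠ-↑ʳ id id j)))
                     (cong₂ _++_ (tabulate∘lookup v) (tabulate∘lookup v))

module _ {S : Signature} where
  open _≈H_

  ≈-refl : ∀ {H K : Hyp S} {f : Hom H K} → f ≈H f
  ≈-refl = record { eqV = λ _ → refl ; eqE = λ _ _ → refl }

  ≈-sym : ∀ {H K : Hyp S} {f g : Hom H K} → f ≈H g → g ≈H f
  ≈-sym p = record { eqV = λ v → sym (eqV p v) ; eqE = λ R x → sym (eqE p R x) }

  ≈-trans : ∀ {H K : Hyp S} {f g h : Hom H K} → f ≈H g → g ≈H h → f ≈H h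
  ≈-trans p q = record { eqV = λ v → trans (eqV p v) (eqV q v)
                       ; eqE = λ R x → trans (eqE p R x) (eqE q R x) }

  ≈-disc : ∀ {n} {K : Hyp S} {f g : Hom ⟦ disc {S} n ⟧ K} → (∀ v → fV f v ≡ fV g v) → f ≈H g
  ≈-disc p = record { eqV = p ; eqE = λ { R (() , _) } }

  ⨾-congʳ : ∀ {A B C : Hyp S} (j : Hom A B) {h h′ : Hom B C} → h ≈H h′ → (j ⨾ h) ≈H (j ⨾ h′)
  ⨾-congʳ j p = record { eqV = λ v → eqV p (fV j v) ; eqE = λ R x → eqE p R (fE j R x) }

-- The pushouts and coproducts of finite
-- hypergraphs used below are universal among all, possibly infinite,
-- hypergraphs: this is what lets them be mapped into G.

module _ {S : Signature} where
  open _≈H_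

  record IsPushout∞ {A B C P : FinHyp S} (f : FHom A B) (g : FHom A C)
                    (j₁ : FHom B P) (j₂ : FHom C P) : Set₁ where
    field
      commutes : (f ⨾ j₁) ≈H (g ⨾ j₂)
      mediator : ∀ {Q : Hyp S} (a : Hom ⟦ B ⟧ Q) (b : Hom ⟦ C ⟧ Q) → (f ⨾ a) ≈H (g ⨾ b) → Hom ⟦ P ⟧ Q
      mediator-β₁ : ∀ {Q : Hyp S} a b eq → (j₁ ⨾ mediator {Q} a b eq) ≈H a
      mediator-β₂ : ∀ {Q : Hyp S} a b eq → (j₂ ⨾ mediator {Q} a b eq) ≈H b
      jointly-epic : ∀ {Q : Hyp S} {u u′ : Hom ⟦ P ⟧ Q} →
        (j₁ ⨾ u) ≈H (j₁ ⨾ u′) → (j₂ ⨾ u) ≈H (j₂ ⨾ u′) → u ≈H u′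

  record IsCoproduct∞ {B C P : FinHyp S} (j₁ : FHom B P) (j₂ : FHom C P) : Set₁ where
    field
      mediator : ∀ {Q : Hyp S} (a : Hom ⟦ B ⟧ Q) (b : Hom ⟦ C ⟧ Q) → Hom ⟦ P ⟧ Q
      mediator-β₁ : ∀ {Q : Hyp S} a b → (j₁ ⨾ mediator {Q} a b) ≈H a
      mediator-β₂ : ∀ {Q : Hyp S} a b → (j₂ ⨾ mediator {Q} a b) ≈H b
      jointly-epic : ∀ {Q : Hyp S} {u u′ : Hom ⟦ P ⟧ Q} →
        (j₁ ⨾ u) ≈H (j₁ ⨾ u′) → (j₂ ⨾ u) ≈H (j₂ ⨾ u′) → u ≈H u′

  toPushout : ∀ {A B C P : FinHyp S} {f : FHom A B} {g : FHom A C} {j₁ : FHom B P} {j₂ : FHom C P} →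
    IsPushout∞ f g j₁ j₂ → IsPushout f g j₁ j₂
  toPushout po = commutes , λ Q a b eq →
    mediator a b eq , mediator-β₁ a b eq , mediator-β₂ a b eq ,
    λ u′ p q → jointly-epic (≈-trans p (≈-sym (mediator-β₁ a b eq))) (≈-trans q (≈-sym (mediator-β₂ a b eq)))
    where open IsPushout∞ po

  toCoproduct : ∀ {B C P : FinHyp S} {j₁ : FHom B P} {j₂ : FHom C P} →
    IsCoproduct∞ j₁ j₂ → IsCoproduct j₁ j₂
  toCoproduct cp Q a b =
    mediator a b , mediator-β₁ a b , mediator-β₂ a b ,
    λ u′ p q → jointly-epic (≈-trans p (≈-sym (mediator-β₁ a b))) (≈-trans q (≈-sym (mediator-β₂ a b)))
    where open IsCoproduct∞ cp

  pushout-swap : ∀ {A B C P : FinHyp S} {f : FHom A B} {g : FHom A C} {j₁ : FHom B P} {j₂ : FHom C P} →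
    IsPushout∞ f g j₁ j₂ → IsPushout∞ g f j₂ j₁
  pushout-swap po = record
    { commutes = ≈-sym commutes
    ; mediator = λ a b eq → mediator b a (≈-sym eq)
    ; mediator-β₁ = λ a b eq → mediator-β₂ b a (≈-sym eq)
    ; mediator-β₂ = λ a b eq → mediator-β₁ b a (≈-sym eq)
    ; jointly-epic = λ p q → jointly-epic q p }
    where open IsPushout∞ po

  coproduct-from-pushout : ∀ {B C P : FinHyp S} {f : FHom (disc 0) B} {g : FHom (disc 0) C}
    {j₁ : FHom B P} {j₂ : FHom C P} → IsPushout∞ f g j₁ j₂ → IsCoproduct∞ j₁ j₂
  coproduct-from-pushout po = record
    { mediator = λ a b → mediator a b (≈-disc λ ())
    ; mediator-β₁ = λ a b → mediator-β₁ a b (≈-disc λ ())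
    ; mediator-β₂ = λ a b → mediator-β₂ a b (≈-disc λ ())
    ; jointly-epic = jointly-epic }
    where open IsPushout∞ po

record IsVertexPushout {n N K P : ℕ} (α : Fin n → Fin N) (β : Fin n → Fin K)
                       (r : Fin N → Fin P) (j : Fin K → Fin P) : Set₁ where
  field
    commutes : ∀ x → r (α x) ≡ j (β x)
    mediate : ∀ {Q : Set} (a : Fin N → Q) (b : Fin K → Q) → (∀ x → a (α x) ≡ b (β x)) → Fin P → Q
    mediate-β₁ : ∀ {Q : Set} a b eq y → mediate {Q} a b eq (r y) ≡ a y
    mediate-β₂ : ∀ {Q : Set} a b eq z → mediate {Q} a b eq (j z) ≡ b z
    jointly-epic : ∀ {Q : Set} {u u′ : Fin P → Q} →
      (∀ y → u (r y) ≡ u′ (r y)) → (∀ z → u (j z) ≡ u′ (j z)) → ∀ p → u p ≡ u′ p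

along-idʳ : ∀ {n N} (α : Fin n → Fin N) → IsVertexPushout α id id α
along-idʳ α = record
  { commutes = λ _ → refl ; mediate = λ a b eq → a
  ; mediate-β₁ = λ a b eq y → refl ; mediate-β₂ = λ a b eq z → eq z
  ; jointly-epic = λ p q → p }

along-idˡ : ∀ {n K} (β : Fin n → Fin K) → IsVertexPushout id β β id
along-idˡ β = record
  { commutes = λ _ → refl ; mediate = λ a b eq → b
  ; mediate-β₁ = λ a b eq y → sym (eq y) ; mediate-β₂ = λ a b eq z → refl
  ; jointly-epic = λ p q → q }

vertex-coproduct : ∀ N K → IsVertexPushout {0} (λ ()) (λ ()) (_↑ˡ K) (N ↑ʳ_)
vertex-coproduct N K = record
  { commutes = λ ()
  ; mediate = λ a b eq → a ++ᶠ b
  ; mediate-β₁ = λ a b eq → ++ᶠ-↑ˡ a b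
  ; mediate-β₂ = λ a b eq → ++ᶠ-↑ʳ a b
  ; jointly-epic = ↑-cases N }

module _ {S : Signature} where
  open _≈H_

  record Renaming (H : FinHyp S) {P : ℕ} (r : Fin (k H) → Fin P) : Set where
    field
      src′ : (i : Fin (e H)) → Vec (Fin P) (ar S (lab H i))
      tgt′ : (i : Fin (e H)) → Vec (Fin P) (coar S (lab H i))
      src′-≡ : ∀ i → src′ i ≡ map r (fsrc H i)
      tgt′-≡ : ∀ i → tgt′ i ≡ map r (ftgt H i)

    renamed : FinHyp S
    renamed = record { k = P ; e = e H ; lab = lab H ; fsrc = src′ ; ftgt = tgt′ }

    rename : FHom H renamed
    rename = record { fV = r ; fE = λ R x → x
                    ; src-comm = λ { R (i , refl) → src′-≡ i }
                    ; tgt-comm = λ { R (i , refl) → tgt′-≡ i } }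

  unrenamed : (H : FinHyp S) → Renaming H id
  unrenamed H = record { src′ = fsrc H ; tgt′ = ftgt H
                       ; src′-≡ = λ i → sym (map-id (fsrc H i)) ; tgt′-≡ = λ i → sym (map-id (ftgt H i)) }

  -- Pushing H out along a map of discrete hypergraphs renames its vertices:
  -- the pushout is computed on vertices, and the edges of H are kept.
  pushout-by-renaming : ∀ {n K P} {H : FinHyp S} {r : Fin (k H) → Fin P} {j : Fin K → Fin P}
    (f : FHom (disc n) H) (g : FHom (disc n) (disc K)) (ρ : Renaming H r) →
    IsVertexPushout (fV f) (fV g) r j → IsPushout∞ f g (Renaming.rename ρ) (discHom j)
  pushout-by-renaming {H = H} {r} f g ρ vp = record
    { commutes = ≈-disc commutes
    ; mediator = mediator
    ; mediator-β₁ = λ a b eq → record { eqV = mediate-β₁ (fV a) (fV b) (eqV eq) ; eqE = λ _ _ → refl }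
    ; mediator-β₂ = λ a b eq → ≈-disc (mediate-β₂ (fV a) (fV b) (eqV eq))
    ; jointly-epic = λ p q → record { eqV = jointly-epic (eqV p) (eqV q) ; eqE = eqE p } }
    where
    open IsVertexPushout vp
    open Renaming ρ
    mediator : ∀ {Q : Hyp S} (a : Hom ⟦ H ⟧ Q) (b : Hom ⟦ disc _ ⟧ Q) → (f ⨾ a) ≈H (g ⨾ b) →
      Hom ⟦ renamed ⟧ Q
    mediator {Q} a b eq = record
      { fV = u ; fE = fE a
      ; src-comm = λ { R (i , refl) → trans (src-comm a R (i , refl)) (endpoints (src′-≡ i)) }
      ; tgt-comm = λ { R (i , refl) → trans (tgt-comm a R (i , refl)) (endpoints (tgt′-≡ i)) } }
      where
      u : Fin _ → V Q
      u = mediate (fV a) (fV b) (eqV eq)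
      endpoints : ∀ {ℓ} {v : Vec (Fin (k H)) ℓ} {v′ : Vec (Fin _) ℓ} → v′ ≡ map r v → map (fV a) v ≡ map u v′
      endpoints {v = v} refl = trans (map-cong (λ y → sym (mediate-β₁ (fV a) (fV b) (eqV eq) y)) v)
                                     (map-∘ u r v)

  pushout-idʳ : ∀ {K} {H : FinHyp S} (f : FHom (disc K) H) →
    IsPushout∞ f idH (Renaming.rename (unrenamed H)) (discHom (fV f))
  pushout-idʳ {H = H} f = pushout-by-renaming f idH (unrenamed H) (along-idʳ (fV f))

  pushout-idˡ : ∀ {K} {H : FinHyp S} (f : FHom (disc K) H) →
    IsPushout∞ idH f (discHom (fV f)) (Renaming.rename (unrenamed H))
  pushout-idˡ f = pushout-swap (pushout-idʳ f)

  add-vertices : ∀ (H : FinHyp S) K (ρ : Renaming H (_↑ˡ K)) →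
    IsCoproduct∞ (Renaming.rename ρ) (discHom {S} (k H ↑ʳ_))
  add-vertices H K ρ = coproduct-from-pushout
    (pushout-by-renaming (discHom (λ ())) (discHom (λ ())) ρ (vertex-coproduct (k H) K))

  disc-inl : ∀ K K′ → Renaming (disc K) (_↑ˡ K′)
  disc-inl K K′ = record { src′ = λ () ; tgt′ = λ () ; src′-≡ = λ () ; tgt′-≡ = λ () }

  disc-coproduct : ∀ K K′ → IsCoproduct∞ (Renaming.rename (disc-inl K K′)) (discHom {S} (K ↑ʳ_))
  disc-coproduct K K′ = add-vertices (disc K) K′ (disc-inl K K′)

  hyp : (K e : ℕ) (l : Fin e → Sym S) → ((i : Fin e) → Vec (Fin K) (ar S (l i))) →
    ((i : Fin e) → Vec (Fin K) (coar S (l i))) → FinHyp S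
  hyp K e l s t = record { k = K ; e = e ; lab = l ; fsrc = s ; ftgt = t }

  cospan : ∀ {n m} (H : FinHyp S) → FHom (disc n) H → FHom (disc m) H → Cospan S n m
  cospan H f g = record { apex = H ; ι = f ; ω = g }

  ⟪_⟫ : (H : FinHyp S) → Cospan S (k H) (k H)
  ⟪ H ⟫ = cospan H (discHom id) (discHom id)

  edgeless-pushout : ∀ {K} (l : Fin 0 → Sym S) s t →
    IsPushout∞ {A = disc K} idH idH (discHom {K = ⟦ hyp K 0 l s t ⟧} id) (discHom id)
  edgeless-pushout l s t = record
    { commutes = ≈-refl
    ; mediator = λ a b eq → record { fV = fV a ; fE = λ R → λ { (() , _) }
                                   ; src-comm = λ R → λ { (() , _) } ; tgt-comm = λ R → λ { (() , _) } }
    ; mediator-β₁ = λ a b eq → ≈-disc (λ _ → refl)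
    ; mediator-β₂ = λ a b eq → ≈-disc (eqV eq)
    ; jointly-epic = λ p q → record { eqV = eqV p ; eqE = λ R → λ { (() , _) } } }

  module FirstEdge {K e : ℕ} (l : Fin (suc e) → Sym S) (s : (i : Fin (suc e)) → Vec (Fin K) (ar S (l i)))
                   (t : (i : Fin (suc e)) → Vec (Fin K) (coar S (l i))) where
    whole rest first : FinHyp S
    whole = hyp K (suc e) l s t
    rest = hyp K e (l ∘ suc) (s ∘ suc) (t ∘ suc)
    first = hyp K 1 (λ _ → l zero) (λ _ → s zero) (λ _ → t zero)

    include-rest : FHom rest whole
    include-rest = record { fV = id ; fE = λ R → λ { (i , p) → (suc i , p) }
                          ; src-comm = λ { R (i , refl) → sym (map-id _) }
                          ; tgt-comm = λ { R (i , refl) → sym (map-id _) } }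

    include-first : FHom first whole
    include-first = record { fV = id ; fE = λ R → λ { (zero , p) → (zero , p) }
                           ; src-comm = λ { R (zero , refl) → sym (map-id _) }
                           ; tgt-comm = λ { R (zero , refl) → sym (map-id _) } }

    split-first-edge : IsPushout∞ {A = disc K} (discHom id) (discHom id) include-rest include-first
    split-first-edge = record
      { commutes = ≈-disc (λ _ → refl)
      ; mediator = mediator
      ; mediator-β₁ = λ a b eq → record { eqV = λ _ → refl ; eqE = λ _ _ → refl }
      ; mediator-β₂ = λ a b eq → record { eqV = eqV eq ; eqE = λ { R (zero , p) → refl } }
      ; jointly-epic = λ p q → record
          { eqV = eqV p
          ; eqE = λ { R (zero , x) → eqE q R (zero , x) ; R (suc i , x) → eqE p R (i , x) } } }
      where
      mediator : ∀ {Q : Hyp S} (a : Hom ⟦ rest ⟧ Q) (b : Hom ⟦ first ⟧ Q) →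
        (discHom id ⨾ a) ≈H (discHom id ⨾ b) → Hom ⟦ whole ⟧ Q
      mediator a b eq = record
        { fV = fV a
        ; fE = λ R → λ { (zero , p) → fE b R (zero , p) ; (suc i , p) → fE a R (i , p) }
        ; src-comm = λ { R (zero , refl) → trans (src-comm b R (zero , refl)) (map-cong (sym ∘ eqV eq) _)
                       ; R (suc i , refl) → src-comm a R (i , refl) }
        ; tgt-comm = λ { R (zero , refl) → trans (tgt-comm b R (zero , refl)) (map-cong (sym ∘ eqV eq) _)
                       ; R (suc i , refl) → tgt-comm a R (i , refl) } }

  -- A single R-edge on K vertices, with sources s and targets t, is obtained from
  -- H_R + K by gluing its targets along [t , id] and then its sources along [s , id].
  module OneEdge (R : Sym S) {K : ℕ} (s : Vec (Fin K) (ar S R)) (t : Vec (Fin K) (coar S R)) where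
    a b : ℕ
    a = ar S R
    b = coar S R

    T-ρ : Renaming H[ R ] (_↑ˡ K)
    T-ρ = record { src′ = λ _ → tabulate (λ i → (i ↑ˡ b) ↑ˡ K)
                 ; tgt′ = λ _ → tabulate (λ j → (a ↑ʳ j) ↑ˡ K)
                 ; src′-≡ = λ _ → tabulate-∘ _ _ ; tgt′-≡ = λ _ → tabulate-∘ _ _ }

    T : FinHyp S
    T = Renaming.renamed T-ρ

    T-coproduct : IsCoproduct∞ (Renaming.rename T-ρ) (discHom {S} ((a + b) ↑ʳ_))
    T-coproduct = add-vertices H[ R ] K T-ρ

    -- the legs of the tensor product ⌊ R ⌋ ⊗ id_K
    in-T : Fin (a + K) → Fin ((a + b) + K)
    in-T = _⊕_ {a} {K} (_↑ˡ b) id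
    out-T : Fin (b + K) → Fin ((a + b) + K)
    out-T = _⊕_ {b} {K} (a ↑ʳ_) id

    glue-t : Fin (b + K) → Fin K
    glue-t = lookup t ++ᶠ id
    -- the induced renaming of the vertices of T: sources, targets, added vertices
    mid-r : Fin ((a + b) + K) → Fin (a + K)
    mid-r = ((_↑ˡ K) ++ᶠ (λ j → a ↑ʳ lookup t j)) ++ᶠ (a ↑ʳ_)

    mid-src : ∀ i → mid-r ((i ↑ˡ b) ↑ˡ K) ≡ i ↑ˡ K
    mid-src i = trans (++ᶠ-↑ˡ _ (a ↑ʳ_) (i ↑ˡ b)) (++ᶠ-↑ˡ (_↑ˡ K) (λ j → a ↑ʳ lookup t j) i)
    mid-tgt : ∀ j → mid-r ((a ↑ʳ j) ↑ˡ K) ≡ a ↑ʳ lookup t j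
    mid-tgt j = trans (++ᶠ-↑ˡ _ (a ↑ʳ_) (a ↑ʳ j)) (++ᶠ-↑ʳ (_↑ˡ K) (λ j → a ↑ʳ lookup t j) j)
    mid-rest : ∀ l → mid-r ((a + b) ↑ʳ l) ≡ a ↑ʳ l
    mid-rest = ++ᶠ-↑ʳ ((_↑ˡ K) ++ᶠ (λ j → a ↑ʳ lookup t j)) (a ↑ʳ_)

    mid-in : ∀ x → mid-r (in-T x) ≡ x
    mid-in = ↑-cases a (λ i → trans (cong mid-r (⊕-↑ˡ (_↑ˡ b) id i)) (mid-src i))
                       (λ l → trans (cong mid-r (⊕-↑ʳ (_↑ˡ b) id l)) (mid-rest l))

    mid-commutes : ∀ x → mid-r (out-T x) ≡ a ↑ʳ glue-t x
    mid-commutes = ↑-cases b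
      (λ j → begin
        mid-r (out-T (j ↑ˡ K))    ≡⟨ cong mid-r (⊕-↑ˡ (a ↑ʳ_) id j) ⟩
        mid-r ((a ↑ʳ j) ↑ˡ K)     ≡⟨ mid-tgt j ⟩
        a ↑ʳ lookup t j           ≡⟨ cong (a ↑ʳ_) (++ᶠ-↑ˡ (lookup t) id j) ⟨
        a ↑ʳ glue-t (j ↑ˡ K)      ∎)
      (λ l → begin
        mid-r (out-T (b ↑ʳ l))    ≡⟨ cong mid-r (⊕-↑ʳ (a ↑ʳ_) id l) ⟩
        mid-r ((a + b) ↑ʳ l)      ≡⟨ mid-rest l ⟩
        a ↑ʳ l                    ≡⟨ cong (a ↑ʳ_) (++ᶠ-↑ʳ (lookup t) id l) ⟨
        a ↑ʳ glue-t (b ↑ʳ l)      ∎)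
      where open ≡-Reasoning

    mid-vertices : IsVertexPushout out-T glue-t mid-r (a ↑ʳ_)
    mid-vertices = record
      { commutes = mid-commutes
      ; mediate = mediate
      ; mediate-β₁ = λ A B eq → ↑-cases (a + b)
          (↑-cases a (λ i → trans (cong (mediate A B eq) (mid-src i)) (++ᶠ-↑ˡ (src-part A) B i))
                     (λ j → trans (cong (mediate A B eq) (mid-tgt j))
                                  (glued A B eq (j ↑ˡ K) (++ᶠ-↑ˡ (lookup t) id j) (⊕-↑ˡ (a ↑ʳ_) id j))))
          (λ l → trans (cong (mediate A B eq) (mid-rest l))
                       (glued A B eq (b ↑ʳ l) (++ᶠ-↑ʳ (lookup t) id l) (⊕-↑ʳ (a ↑ʳ_) id l)))
      ; mediate-β₂ = λ A B eq → ++ᶠ-↑ʳ (src-part A) B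
      ; jointly-epic = λ {_} {u} {u′} p q → ↑-cases a
          (λ i → subst (λ v → u v ≡ u′ v) (mid-src i) (p ((i ↑ˡ b) ↑ˡ K))) q }
      where
      src-part : ∀ {Q : Set} → (Fin ((a + b) + K) → Q) → Fin a → Q
      src-part A i = A ((i ↑ˡ b) ↑ˡ K)
      mediate : ∀ {Q : Set} (A : Fin ((a + b) + K) → Q) (B : Fin K → Q) → (∀ x → A (out-T x) ≡ B (glue-t x)) →
        Fin (a + K) → Q
      mediate A B eq = src-part A ++ᶠ B
      glued : ∀ {Q : Set} (A : Fin ((a + b) + K) → Q) (B : Fin K → Q) (eq : ∀ x → A (out-T x) ≡ B (glue-t x)) →
        ∀ x {y z} → glue-t x ≡ y → out-T x ≡ z → mediate A B eq (a ↑ʳ y) ≡ A z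
      glued A B eq x refl refl = trans (++ᶠ-↑ʳ (src-part A) B (glue-t x)) (sym (eq x))

    Mid-ρ : Renaming T mid-r
    Mid-ρ = record
      { src′ = λ _ → tabulate (_↑ˡ K) ; tgt′ = λ _ → tabulate (λ j → a ↑ʳ lookup t j)
      ; src′-≡ = λ _ → tabulate-rename mid-r mid-src ; tgt′-≡ = λ _ → tabulate-rename mid-r mid-tgt }

    Mid : FinHyp S
    Mid = Renaming.renamed Mid-ρ

    mid-pushout : IsPushout∞ (discHom out-T) (discHom glue-t) (Renaming.rename Mid-ρ) (discHom (a ↑ʳ_))
    mid-pushout = pushout-by-renaming (discHom out-T) (discHom glue-t) Mid-ρ mid-vertices

    glue-s : Fin (a + K) → Fin K
    glue-s = lookup s ++ᶠ id

    Edge-ρ : Renaming Mid glue-s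
    Edge-ρ = record
      { src′ = λ _ → s ; tgt′ = λ _ → t
      ; src′-≡ = λ _ → trans (sym (tabulate∘lookup s)) (tabulate-rename glue-s (++ᶠ-↑ˡ (lookup s) id))
      ; tgt′-≡ = λ _ → trans (sym (tabulate∘lookup t))
                              (tabulate-rename glue-s (λ j → ++ᶠ-↑ʳ (lookup s) id (lookup t j))) }

    Edge : FinHyp S
    Edge = Renaming.renamed Edge-ρ

    edge-pushout : IsPushout∞ (discHom glue-s) (discHom id) (discHom id) (Renaming.rename Edge-ρ)
    edge-pushout = pushout-swap (pushout-by-renaming (discHom id) (discHom glue-s) Edge-ρ (along-idˡ glue-s))

⨾S-≡ : ∀ {X Y Z} {P : Span X Y} {Q : Span Y Z} {a a′ : top P} {b b′ : top Q}
  {eq : rgt P a ≡ lft Q b} {eq′ : rgt P a′ ≡ lft Q b′} →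
  a ≡ a′ → b ≡ b′ → _≡_ {A = top (P ⨾S Q)} ((a , b) , eq) ((a′ , b′) , eq′)
⨾S-≡ {a = a} {b = b} refl refl = cong ((a , b) ,_) (uip _ _)

same-apex : ∀ {X Y T : Set} {l l′ : T → X} {r r′ : T → Y} → (∀ a → l′ a ≡ l a) → (∀ a → r′ a ≡ r a) →
  _≅S_ {X} {Y} (record { top = T ; lft = l ; rgt = r }) (record { top = T ; lft = l′ ; rgt = r′ })
same-apex l-eq r-eq = record { φ = id ; ψ = id ; ψφ = λ _ → refl ; φψ = λ _ → refl
                             ; l-comm = l-eq ; r-comm = r-eq }

precomp : (A : Set) {n m : ℕ} (K : ℕ) → (Fin n → Fin K) → (Fin m → Fin K) → Span (Vec A n) (Vec A m)
precomp A K f g = record { top = Vec A K ; lft = λ v → tabulate (lookup v ∘ f)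
                         ; rgt = λ v → tabulate (lookup v ∘ g) }

module HomSpans {S : Signature} (G : Hyp S) where
  open _≈H_

  -- P presents the homomorphisms from the apex of c into G: P is isomorphic to the
  -- hom-span of c, by an isomorphism whose inverse respects equality of homomorphisms.
  record HomIso {n m} (P : Span (Vec (V G) n) (Vec (V G) m)) (c : Cospan S n m) : Set where
    field
      iso : SpanIsoBy P (homSpan G c) _≈H_
      ψ-resp : ∀ {h h′} → h ≈H h′ → SpanIsoBy.ψ iso h ≡ SpanIsoBy.ψ iso h′
    open SpanIsoBy iso public

    lft-ψ : ∀ h → lft P (ψ h) ≡ homVec (ι c ⨾ h)
    lft-ψ h = trans (sym (l-comm (ψ h))) (tabulate-cong (λ v → eqV (φψ h) (fV (ι c) v)))

    rgt-ψ : ∀ h → rgt P (ψ h) ≡ homVec (ω c ⨾ h)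
    rgt-ψ h = trans (sym (r-comm (ψ h))) (tabulate-cong (λ v → eqV (φψ h) (fV (ω c) v)))

  infixr 4 _◂_
  _◂_ : ∀ {n m} {P Q : Span (Vec (V G) n) (Vec (V G) m)} {c : Cospan S n m} →
    P ≅S Q → HomIso Q c → HomIso P c
  I ◂ J = record
    { iso = record
      { φ = J.φ ∘ I.φ ; ψ = I.ψ ∘ J.ψ
      ; ψφ = λ a → trans (cong I.ψ (J.ψφ (I.φ a))) (I.ψφ a)
      ; φψ = λ h → subst (λ b → J.φ b ≈H h) (sym (I.φψ (J.ψ h))) (J.φψ h)
      ; l-comm = λ a → trans (J.l-comm (I.φ a)) (I.l-comm a)
      ; r-comm = λ a → trans (J.r-comm (I.φ a)) (I.r-comm a) }
    ; ψ-resp = λ p → cong I.ψ (J.ψ-resp p) }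
    where module I = SpanIsoBy I
          module J = HomIso J

  homIso-legs : ∀ {n m} {P : Span (Vec (V G) n) (Vec (V G) m)} {H : FinHyp S}
    {f f′ : FHom (disc n) H} {g g′ : FHom (disc m) H} →
    (∀ x → fV f x ≡ fV f′ x) → (∀ y → fV g y ≡ fV g′ y) → HomIso P (cospan H f g) → HomIso P (cospan H f′ g′)
  homIso-legs f-eq g-eq I = record
    { iso = record
      { φ = φ ; ψ = ψ ; ψφ = ψφ ; φψ = φψ
      ; l-comm = λ a → trans (tabulate-cong (λ x → cong (fV (φ a)) (sym (f-eq x)))) (l-comm a)
      ; r-comm = λ a → trans (tabulate-cong (λ y → cong (fV (φ a)) (sym (g-eq y)))) (r-comm a) }
    ; ψ-resp = ψ-resp }
    where open HomIso I

  homIso-discrete : ∀ {n m K} (f : FHom (disc n) (disc K)) (g : FHom (disc m) (disc K)) →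
    HomIso (precomp (V G) K (fV f) (fV g)) (cospan (disc K) f g)
  homIso-discrete f g = record
    { iso = record
      { φ = λ v → discHom (lookup v) ; ψ = λ h → tabulate (fV h)
      ; ψφ = tabulate∘lookup ; φψ = λ h → ≈-disc (lookup∘tabulate (fV h))
      ; l-comm = λ _ → refl ; r-comm = λ _ → refl }
    ; ψ-resp = λ p → tabulate-cong (eqV p) }

  homIso-generator : ∀ R → HomIso (genSpan G R) ⌊ R ⌋
  homIso-generator R = record
    { iso = record
      { φ = edge-hom ; ψ = λ h → fE h R (zero , refl) ; ψφ = λ _ → refl
      ; φψ = λ h → record { eqV = ↑-cases a (source-of h) (target-of h)
                          ; eqE = λ { _ (zero , refl) → refl } }
      ; l-comm = sources ; r-comm = targets }
    ; ψ-resp = λ p → eqE p R (zero , refl) }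
    where
    a b : ℕ
    a = ar S R
    b = coar S R
    ends : E G R → Vec (V G) (a + b)
    ends x = src G R x ++ tgt G R x
    sources : ∀ x → tabulate (lookup (ends x) ∘ (_↑ˡ b)) ≡ src G R x
    sources x = trans (tabulate-cong (lookup-++ˡ (src G R x) (tgt G R x))) (tabulate∘lookup _)
    targets : ∀ x → tabulate (lookup (ends x) ∘ (a ↑ʳ_)) ≡ tgt G R x
    targets x = trans (tabulate-cong (lookup-++ʳ (src G R x) (tgt G R x))) (tabulate∘lookup _)
    edge-hom : E G R → Hom ⟦ H[ R ] ⟧ G
    edge-hom x = record
      { fV = lookup (ends x) ; fE = λ { _ (_ , refl) → x }
      ; src-comm = λ { _ (_ , refl) → trans (sym (sources x)) (tabulate-∘ (lookup (ends x)) _) }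
      ; tgt-comm = λ { _ (_ , refl) → trans (sym (targets x)) (tabulate-∘ (lookup (ends x)) _) } }
    lookup-image : ∀ (h : Hom ⟦ H[ R ] ⟧ G) {ℓ} {v} (F : Fin ℓ → Fin (a + b)) → v ≡ map (fV h) (tabulate F) →
      ∀ i → lookup v i ≡ fV h (F i)
    lookup-image h F refl i = trans (lookup-map i (fV h) (tabulate F)) (cong (fV h) (lookup∘tabulate F i))
    -- h is the edge homomorphism of the image of its edge: on sources and on targets
    source-of : ∀ h i → lookup (ends (fE h R (zero , refl))) (i ↑ˡ b) ≡ fV h (i ↑ˡ b)
    source-of h i = trans (lookup-++ˡ (src G R _) (tgt G R _) i)
                          (lookup-image h (_↑ˡ b) (src-comm h R (zero , refl)) i)
    target-of : ∀ h j → lookup (ends (fE h R (zero , refl))) (a ↑ʳ j) ≡ fV h (a ↑ʳ j)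
    target-of h j = trans (lookup-++ʳ (src G R _) (tgt G R _) j)
                          (lookup-image h (a ↑ʳ_) (tgt-comm h R (zero , refl)) j)

  restrict-leg : ∀ {n} {A B : FinHyp S} {f : FHom (disc n) A} {f′ : FHom (disc n) B} {j : FHom A B}
    {u : Hom ⟦ B ⟧ G} {h : Hom ⟦ A ⟧ G} → (f ⨾ j) ≈H f′ → (j ⨾ u) ≈H h → homVec (f′ ⨾ u) ≡ homVec (f ⨾ h)
  restrict-leg {f = f} {u = u} f-eq u-eq =
    tabulate-cong (λ v → trans (cong (fV u) (sym (eqV f-eq v))) (eqV u-eq (fV f v)))

  -- Hom(-, G) turns pushouts into pullbacks: if P and Q present the homomorphisms
  -- out of c and d, then P ⨾S Q presents those out of a pushout x of c ; d.
  homIso-⨾ : ∀ {n m p} {c : Cospan S n m} {d : Cospan S m p} {x : Cospan S n p}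
    {P : Span (Vec (V G) n) (Vec (V G) m)} {Q : Span (Vec (V G) m) (Vec (V G) p)}
    {j₁ : FHom (apex c) (apex x)} {j₂ : FHom (apex d) (apex x)} →
    IsPushout∞ (ω c) (ι d) j₁ j₂ → (ι c ⨾ j₁) ≈H ι x → (ω d ⨾ j₂) ≈H ω x →
    HomIso P c → HomIso Q d → HomIso (P ⨾S Q) x
  homIso-⨾ {c = c} {d} {x} {P} {Q} {j₁} {j₂} po ι-eq ω-eq I J = record
    { iso = record
      { φ = glue ; ψ = restrict
      ; ψφ = λ { p@((a , b) , _) →
          ⨾S-≡ {P = P} {Q = Q} (trans (I.ψ-resp (mediator-β₁ _ _ (compatible p))) (I.ψφ a))
               (trans (J.ψ-resp (mediator-β₂ _ _ (compatible p))) (J.ψφ b)) }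
      ; φψ = λ h → jointly-epic (≈-trans (mediator-β₁ _ _ _) (I.φψ (j₁ ⨾ h)))
                                (≈-trans (mediator-β₂ _ _ _) (J.φψ (j₂ ⨾ h)))
      ; l-comm = λ { p@((a , _) , _) →
          trans (restrict-leg {u = glue p} ι-eq (mediator-β₁ _ _ (compatible p))) (I.l-comm a) }
      ; r-comm = λ { p@((_ , b) , _) →
          trans (restrict-leg {u = glue p} ω-eq (mediator-β₂ _ _ (compatible p))) (J.r-comm b) } }
    ; ψ-resp = λ q → ⨾S-≡ {P = P} {Q = Q} (I.ψ-resp (⨾-congʳ j₁ q)) (J.ψ-resp (⨾-congʳ j₂ q)) }
    where
    open IsPushout∞ po
    module I = HomIso I
    module J = HomIso J
    compatible : ∀ (p : top (P ⨾S Q)) → (ω c ⨾ I.φ (proj₁ (proj₁ p))) ≈H (ι d ⨾ J.φ (proj₂ (proj₁ p)))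
    compatible ((a , b) , eq) =
      ≈-disc (tabulate-injective (trans (I.r-comm a) (trans eq (sym (J.l-comm b)))))
    glue : top (P ⨾S Q) → Hom ⟦ apex x ⟧ G
    glue p = mediator _ _ (compatible p)
    restrict : Hom ⟦ apex x ⟧ G → top (P ⨾S Q)
    restrict h = (I.ψ (j₁ ⨾ h) , J.ψ (j₂ ⨾ h)) , (begin
      rgt P (I.ψ (j₁ ⨾ h))      ≡⟨ I.rgt-ψ (j₁ ⨾ h) ⟩
      homVec (ω c ⨾ (j₁ ⨾ h))   ≡⟨ tabulate-cong (λ v → cong (fV h) (eqV commutes v)) ⟩
      homVec (ι d ⨾ (j₂ ⨾ h))   ≡⟨ J.lft-ψ (j₂ ⨾ h) ⟨
      lft Q (J.ψ (j₂ ⨾ h))      ∎)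
      where open ≡-Reasoning

  restrict-summand : ∀ {n n′} {A B : FinHyp S} (g : FHom (disc n) (disc n′)) (f : FHom (disc n) A)
    (f′ : FHom (disc n′) B) (j : FHom A B) (u : Hom ⟦ B ⟧ G) (h : Hom ⟦ A ⟧ G) →
    (g ⨾ f′) ≈H (f ⨾ j) → (j ⨾ u) ≈H h → ∀ i → fV u (fV f′ (fV g i)) ≡ fV h (fV f i)
  restrict-summand g f f′ j u h f-eq u-eq i = trans (cong (fV u) (eqV f-eq i)) (eqV u-eq (fV f i))

  -- Hom(-, G) turns coproducts into products: if P and Q present the homomorphisms
  -- out of c and d, then P ⊗S Q presents those out of a coproduct x of c and d.
  homIso-⊗ : ∀ {n m n′ m′} {c : Cospan S n m} {d : Cospan S n′ m′} {x : Cospan S (n + n′) (m + m′)}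
    {P : Span (Vec (V G) n) (Vec (V G) m)} {Q : Span (Vec (V G) n′) (Vec (V G) m′)}
    {j₁ : FHom (apex c) (apex x)} {j₂ : FHom (apex d) (apex x)} → IsCoproduct∞ j₁ j₂ →
    (inlD n n′ ⨾ ι x) ≈H (ι c ⨾ j₁) → (inrD n n′ ⨾ ι x) ≈H (ι d ⨾ j₂) →
    (inlD m m′ ⨾ ω x) ≈H (ω c ⨾ j₁) → (inrD m m′ ⨾ ω x) ≈H (ω d ⨾ j₂) →
    HomIso P c → HomIso Q d → HomIso (P ⊗S Q) x
  homIso-⊗ {n} {m} {n′} {m′} {c} {d} {x} {P} {Q} {j₁}  {j₂} cp ιˡ ιʳ ωˡ ωʳ I J = record
    { iso = record
      { φ = λ { (a , b) → glue a b }
      ; ψ = λ h → I.ψ (j₁ ⨾ h) , J.ψ (j₂ ⨾ h)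
      ; ψφ = λ { (a , b) → cong₂ _,_ (trans (I.ψ-resp (mediator-β₁ _ _)) (I.ψφ a))
                                      (trans (J.ψ-resp (mediator-β₂ _ _)) (J.ψφ b)) }
      ; φψ = λ h → jointly-epic (≈-trans (mediator-β₁ _ _) (I.φψ (j₁ ⨾ h)))
                                (≈-trans (mediator-β₂ _ _) (J.φψ (j₂ ⨾ h)))
      ; l-comm = λ { (a , b) → trans (lft-glue a b) (cong₂ _++_ (I.l-comm a) (J.l-comm b)) }
      ; r-comm = λ { (a , b) → trans (rgt-glue a b) (cong₂ _++_ (I.r-comm a) (J.r-comm b)) } }
    ; ψ-resp = λ q → cong₂ _,_ (I.ψ-resp (⨾-congʳ j₁ q)) (J.ψ-resp (⨾-congʳ j₂ q)) }
    where
    open IsCoproduct∞ cp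
    module I = HomIso I
    module J = HomIso J
    glue : top P → top Q → Hom ⟦ apex x ⟧ G
    glue a b = mediator (I.φ a) (J.φ b)
    lft-glue : ∀ a b → homVec (ι x ⨾ glue a b) ≡ homVec (ι c ⨾ I.φ a) ++ homVec (ι d ⨾ J.φ b)
    lft-glue a b = tabulate-split
      (restrict-summand (inlD n n′) (ι c) (ι x) j₁ (glue a b) (I.φ a) ιˡ (mediator-β₁ (I.φ a) (J.φ b)))
      (restrict-summand (inrD n n′) (ι d) (ι x) j₂ (glue a b) (J.φ b) ιʳ (mediator-β₂ (I.φ a) (J.φ b)))
    rgt-glue : ∀ a b → homVec (ω x ⨾ glue a b) ≡ homVec (ω c ⨾ I.φ a) ++ homVec (ω d ⨾ J.φ b)
    rgt-glue a b = tabulate-split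
      (restrict-summand (inlD m m′) (ω c) (ω x) j₁ (glue a b) (I.φ a) ωˡ (mediator-β₁ (I.φ a) (J.φ b)))
      (restrict-summand (inrD m m′) (ω d) (ω x) j₂ (glue a b) (J.φ b) ωʳ (mediator-β₂ (I.φ a) (J.φ b)))

module Agreement (S : Signature) (G : Hyp S) (U : CospanToSpan S (V G))
                 (U-pcb : IsPCBMorphism S (V G) U) (U-gen : ∀ (R : Sym S) → U ⌊ R ⌋ ≅S genSpan G R) where
  open IsPCBMorphism U-pcb
  open HomSpans G

  Agrees : ∀ {n m} → Cospan S n m → Set
  Agrees c = HomIso (U c) c

  agrees-legs : ∀ {n m} {H : FinHyp S} {f f′ : FHom (disc n) H} {g g′ : FHom (disc m) H} →
    (∀ x → fV f x ≡ fV f′ x) → (∀ y → fV g y ≡ fV g′ y) → Agrees (cospan H f g) → Agrees (cospan H f′ g′)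
  agrees-legs {H = H} {f} {f′} {g} {g′} f-eq g-eq A = resp-iso same-cospan ◂ homIso-legs f-eq g-eq A
    where
    same-cospan : CospanIso (cospan H f′ g′) (cospan H f g)
    same-cospan = record
      { to = idH ; from = idH
      ; from∘to = record { eqV = λ _ → refl ; eqE = λ _ _ → refl }
      ; to∘from = record { eqV = λ _ → refl ; eqE = λ _ _ → refl }
      ; ι-comm = ≈-disc (λ x → sym (f-eq x)) ; ω-comm = ≈-disc (λ y → sym (g-eq y)) }

  -- Agreement is preserved by composition and tensor (U being a functor,
  -- Hom(-, G) turning pushouts into pullbacks and coproducts into products).
  agrees-⨾ : ∀ {n m p} {c : Cospan S n m} {d : Cospan S m p} {x : Cospan S n p}
    {j₁ : FHom (apex c) (apex x)} {j₂ : FHom (apex d) (apex x)} →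
    IsPushout∞ (ω c) (ι d) j₁ j₂ → (ι c ⨾ j₁) ≈H ι x → (ω d ⨾ j₂) ≈H ω x →
    Agrees c → Agrees d → Agrees x
  agrees-⨾ {c = c} {d} {x} {j₁} {j₂} po ι-eq ω-eq A B =
    pres-comp c d x (j₁ , j₂ , toPushout po , ι-eq , ω-eq) ◂ homIso-⨾ po ι-eq ω-eq A B

  agrees-⊗ : ∀ {n m n′ m′} {c : Cospan S n m} {d : Cospan S n′ m′} {x : Cospan S (n + n′) (m + m′)}
    {j₁ : FHom (apex c) (apex x)} {j₂ : FHom (apex d) (apex x)} → IsCoproduct∞ j₁ j₂ →
    (inlD n n′ ⨾ ι x) ≈H (ι c ⨾ j₁) → (inrD n n′ ⨾ ι x) ≈H (ι d ⨾ j₂) →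
    (inlD m m′ ⨾ ω x) ≈H (ω c ⨾ j₁) → (inrD m m′ ⨾ ω x) ≈H (ω d ⨾ j₂) →
    Agrees c → Agrees d → Agrees x
  agrees-⊗ {c = c} {d} {x} {j₁} {j₂} cp ιˡ ιʳ ωˡ ωʳ A B =
    pres-tensor c d x (j₁ , j₂ , toCoproduct cp , ιˡ , ιʳ , ωˡ , ωʳ) ◂ homIso-⊗ cp ιˡ ιʳ ωˡ ωʳ A B

  agrees-generator : ∀ R → Agrees ⌊ R ⌋
  agrees-generator R = U-gen R ◂ homIso-generator R

  agrees-id : ∀ K → Agrees (idC K)
  agrees-id K = pres-id K ◂ same-apex tabulate∘lookup tabulate∘lookup ◂ homIso-discrete idH idH

  agrees-η : ∀ K → Agrees (ηC K)
  agrees-η K = pres-η K ◂ same-apex (λ _ → refl) tabulate∘lookup ◂ homIso-discrete (ι (ηC K)) idH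

  agrees-ε : ∀ K → Agrees (εC K)
  agrees-ε K = pres-ε K ◂ same-apex tabulate∘lookup (λ _ → refl) ◂ homIso-discrete idH (ω (εC K))

  agrees-μ : ∀ K → Agrees (μC K)
  agrees-μ K = pres-μ K ◂ same-apex tabulate-∇ tabulate∘lookup ◂ homIso-discrete (ι (μC K)) idH

  agrees-δ : ∀ K → Agrees (δC K)
  agrees-δ K = pres-δ K ◂ same-apex tabulate∘lookup tabulate-∇ ◂ homIso-discrete idH (ω (δC K))

  fun : ∀ {n K} → (Fin n → Fin K) → Cospan S n K
  fun {K = K} f = cospan (disc K) (discHom f) idH

  op : ∀ {m K} → (Fin m → Fin K) → Cospan S K m
  op {K = K} g = cospan (disc K) idH (discHom g)

  -- Every function cospan is generated from identities, the codiagonal and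
  -- the empty map by tensor and composition, so U agrees with Hom(-, G) on it.
  fun-cong : ∀ {n K} {f f′ : Fin n → Fin K} → (∀ x → f x ≡ f′ x) → Agrees (fun f) → Agrees (fun f′)
  fun-cong f-eq = agrees-legs f-eq (λ _ → refl)

  fun-⊕ : ∀ {n n′ K K′} {f : Fin n → Fin K} {f′ : Fin n′ → Fin K′} →
    Agrees (fun f) → Agrees (fun f′) → Agrees (fun (f ⊕ f′))
  fun-⊕ {K = K} {K′} {f} {f′} = agrees-⊗ (disc-coproduct K K′)
    (≈-disc (⊕-↑ˡ f f′)) (≈-disc (⊕-↑ʳ f f′)) (≈-disc (λ _ → refl)) (≈-disc (λ _ → refl))

  fun-∘ : ∀ {n K L} {f : Fin n → Fin K} {g : Fin K → Fin L} →
    Agrees (fun f) → Agrees (fun g) → Agrees (fun (g ∘ f))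
  fun-∘ {g = g} = agrees-⨾ (pushout-idˡ (discHom g)) (≈-disc (λ _ → refl)) (≈-disc (λ _ → refl))

  -- a point j : 1 → K is  id₁ ⊕ ∅  if j = 0, and  ∅ ⊕ (a point of K - 1)  otherwise
  fun-point : ∀ {K} (j : Fin K) → Agrees (fun {1} (λ _ → j))
  fun-point {suc K} zero =
    fun-cong (λ { zero → refl }) (fun-⊕ (agrees-legs (λ _ → refl) (λ _ → refl) (agrees-id 1)) (agrees-η K))
  fun-point {suc K} (suc j) = fun-cong (λ { zero → refl }) (fun-⊕ (agrees-η 1) (fun-point j))

  -- f : 1 + n → K is  ∇ ∘ (f 0 ⊕ f ∘ suc)
  fun-all : ∀ {n K} (f : Fin n → Fin K) → Agrees (fun f)
  fun-all {zero} {K} f = fun-cong (λ ()) (agrees-η K)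
  fun-all {suc n} {K} f = fun-cong merged (fun-∘ (fun-⊕ (fun-point (f zero)) (fun-all (f ∘ suc))) (agrees-μ K))
    where
    merged : ∀ x → ∇ K (((λ _ → f zero) ⊕ (f ∘ suc)) x) ≡ f x
    merged zero = ++ᶠ-↑ˡ id id (f zero)
    merged (suc y) = ++ᶠ-↑ʳ id id (f (suc y))

  op-cong : ∀ {m K} {g g′ : Fin m → Fin K} → (∀ x → g x ≡ g′ x) → Agrees (op g) → Agrees (op g′)
  op-cong g-eq = agrees-legs (λ _ → refl) g-eq

  op-⊕ : ∀ {m m′ K K′} {g : Fin m → Fin K} {g′ : Fin m′ → Fin K′} →
    Agrees (op g) → Agrees (op g′) → Agrees (op (g ⊕ g′))
  op-⊕ {K = K} {K′} {g} {g′} = agrees-⊗ (disc-coproduct K K′)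
    (≈-disc (λ _ → refl)) (≈-disc (λ _ → refl)) (≈-disc (⊕-↑ˡ g g′)) (≈-disc (⊕-↑ʳ g g′))

  op-∘ : ∀ {K m p} {g : Fin m → Fin K} {h : Fin p → Fin m} →
    Agrees (op g) → Agrees (op h) → Agrees (op (g ∘ h))
  op-∘ {g = g} = agrees-⨾ (pushout-idʳ (discHom g)) (≈-disc (λ _ → refl)) (≈-disc (λ _ → refl))

  op-point : ∀ {K} (j : Fin K) → Agrees (op {1} (λ _ → j))
  op-point {suc K} zero =
    op-cong (λ { zero → refl }) (op-⊕ (agrees-legs (λ _ → refl) (λ _ → refl) (agrees-id 1)) (agrees-ε K))
  op-point {suc K} (suc j) = op-cong (λ { zero → refl }) (op-⊕ (agrees-ε 1) (op-point j))

  op-all : ∀ {m K} (g : Fin m → Fin K) → Agrees (op g)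
  op-all {zero} {K} g = op-cong (λ ()) (agrees-ε K)
  op-all {suc m} {K} g = op-cong merged (op-∘ (agrees-δ K) (op-⊕ (op-point (g zero)) (op-all (g ∘ suc))))
    where
    merged : ∀ x → ∇ K (((λ _ → g zero) ⊕ (g ∘ suc)) x) ≡ g x
    merged zero = ++ᶠ-↑ˡ id id (g zero)
    merged (suc y) = ++ᶠ-↑ʳ id id (g (suc y))

  agrees-one-edge : ∀ R {K} (s : Vec (Fin K) (ar S R)) (t : Vec (Fin K) (coar S R)) →
    Agrees ⟪ OneEdge.Edge {S} R s t ⟫
  agrees-one-edge R {K} s t =
    agrees-⨾ edge-pushout (≈-disc (λ _ → refl)) (≈-disc (++ᶠ-↑ʳ (lookup s) id)) (op-all glue-s) agrees-Mid
    where
    open OneEdge {S} R s t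
    agrees-T : Agrees (cospan T (discHom in-T) (discHom out-T))
    agrees-T = agrees-⊗ T-coproduct
      (≈-disc (⊕-↑ˡ (_↑ˡ b) id)) (≈-disc (⊕-↑ʳ (_↑ˡ b) id))
      (≈-disc (⊕-↑ˡ (a ↑ʳ_) id)) (≈-disc (⊕-↑ʳ (a ↑ʳ_) id))
      (agrees-generator R) (agrees-id K)
    agrees-Mid : Agrees (cospan Mid (discHom id) (discHom (a ↑ʳ_)))
    agrees-Mid = agrees-⨾ mid-pushout (≈-disc mid-in) (≈-disc (λ _ → refl)) agrees-T (fun-all glue-t)

  agrees-vertices : ∀ K e l s t → Agrees ⟪ hyp K e l s t ⟫
  agrees-vertices K zero l s t =
    agrees-⨾ (edgeless-pushout l s t) (≈-disc (λ _ → refl)) (≈-disc (λ _ → refl)) (agrees-id K) (agrees-id K)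
  agrees-vertices K (suc e) l s t =
    agrees-⨾ split-first-edge (≈-disc (λ _ → refl)) (≈-disc (λ _ → refl))
      (agrees-vertices K e (l ∘ suc) (s ∘ suc) (t ∘ suc)) (agrees-one-edge (l zero) (s zero) (t zero))
    where open FirstEdge {S} l s t

  -- Every cospan n → H ← m is  fun ι ; ⟪ H ⟫ ; op ω.
  agrees : ∀ {n m} (c : Cospan S n m) → Agrees c
  agrees c = agrees-⨾ (pushout-idˡ (discHom id)) (≈-disc (λ _ → refl)) (≈-disc (λ _ → refl))
    (fun-all (fV (ι c))) agrees-output
    where
    H : FinHyp S
    H = apex c
    agrees-output : Agrees (cospan H (discHom id) (ω c))
    agrees-output = agrees-⨾ (pushout-idʳ (discHom id)) (≈-disc (λ _ → refl)) (≈-disc (λ _ → refl))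
      (agrees-vertices (k H) (e H) (lab H) (fsrc H) (ftgt H)) (op-all (fV (ω c)))

mainTheorem10 : (S : Signature) (G : Hyp S) (U : CospanToSpan S (V G)) →
    IsPCBMorphism S (V G) U →
    (∀ (R : Sym S) → U ⌊ R ⌋ ≅S genSpan G R) →
    ∀ {n m} (c : Cospan S n m) → SpanIsoBy (U c) (homSpan G c) _≈H_
mainTheorem10 S G U U-pcb U-gen c = HomSpans.HomIso.iso (Agreement.agrees S G U U-pcb U-gen c)
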